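{- Let $q=2n+1$ be an odd prime power with $3\nmid q$, and write $\mathbb{F}_q^{\times 2}=\{x^2:x\in\mathbb{F}_q^\times\}=\{\alpha_1,\dots,\alpha_n\}$. Let $\mathrm{inv}_q$ be the permutation of $\alpha_1,\dots,\alpha_n$ given by $\alpha_i\mapsto\alpha_i^{ -1}$. Then $$\mathrm{sgn}(\mathrm{inv}_q)=\begin{cases}(-1)^{(n-1)/2}&\text{if } q\equiv 3\pmod 4,\\ 1&\text{if } q\equiv5\pmod 8,\\ -1&\text{if } q\equiv 1\pmod 8.\end{cases}$$ -}

module Defs where

open import Level using (Level)
open import Data.Nat using (ℕ; zero; suc; _<_; _^_)
open import Data.Nat.Primality using (Prime)
open import Data.Fin using (Fin; toℕ)
open import Data.Fin.Properties using (_<?_)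
open import Data.List using (List; length; filter; concatMap; allFin)
open import Data.Product using (Σ; ∃; _×_; _,_)
open import Data.Integer using (ℤ; 1ℤ; -1ℤ)
open import Data.Nat using (_%_)
open import Relation.Nullary using (¬_)
open import Relation.Nullary.Decidable using (_×-dec_)
open import Relation.Binary.PropositionalEquality using (_≡_)
open import Algebra.Bundles using (CommutativeRing)

IsPrimePower : ℕ → Set
IsPrimePower q = Σ ℕ λ p → Σ ℕ λ k → Prime p × (0 < k) × (q ≡ p ^ k)

record IsField {c ℓ : Level} (R : CommutativeRing c ℓ) : Set (c Level.⊔ ℓ) where
  open CommutativeRing R
  field
    0≉1     : ¬ (0# ≈ 1#)
    inverse : ∀ x → ¬ (x ≈ 0#) → Σ Carrier λ y → (x * y) ≈ 1#

record HasCardinality {c ℓ : Level} (R : CommutativeRing c ℓ) (q : ℕ) : Set (c Level.⊔ ℓ) where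
  open CommutativeRing R
  field
    enum     : Fin q → Carrier
    enum-inj : ∀ i j → enum i ≈ enum j → i ≡ j
    enum-sur : ∀ x → Σ (Fin q) λ i → enum i ≈ x

record EnumeratesNonzeroSquares {c ℓ : Level} (R : CommutativeRing c ℓ) (n : ℕ)
         (α : Fin n → CommutativeRing.Carrier R) : Set (c Level.⊔ ℓ) where
  open CommutativeRing R
  field
    α-inj    : ∀ i j → α i ≈ α j → i ≡ j
    α-square : ∀ i → Σ Carrier λ x → ¬ (x ≈ 0#) × (α i ≈ (x * x))
    α-sur    : ∀ x → ¬ (x ≈ 0#) → Σ (Fin n) λ i → α i ≈ (x * x)

inversions : ∀ {n} → (Fin n → Fin n) → ℕ
inversions {n} σ =
  length (filter (λ (p : Fin n × Fin n) → let (i , j) = p in (i <? j) ×-dec (σ j <? σ i))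
                 (concatMap (λ i → Data.List.map (λ j → (i , j)) (allFin n)) (allFin n)))

sgn : ∀ {n} → (Fin n → Fin n) → ℤ
sgn σ with inversions σ % 2
... | zero = 1ℤ
... | suc _ = -1ℤ

{-# OPTIONS --safe #-}
-- Inversion α ↦ α⁻¹ is an involution σ, and the sign of an involution is (−1)^t, where t is
-- the number of its 2-cycles, i.e. of the i with i < σ i: the map (i, j) ↦ (σ j, σ i) pairs up
-- the inversions of σ, leaving unpaired exactly the t inversions (i, σ i).
-- The fixed points of σ are the squares with α² = 1, i.e. α = ±1; as 1 is a square there are
-- f ∈ {1, 2} of them and n = 2t + f, so f is determined by the parity of n, and the three cases
-- follow by reading off t from n and q = 2n + 1 modulo 4 and 8.
module Submission where

open import Defs
open import Level using (Level)
open import Algebra.Bundles using (CommutativeRing)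
open import Data.Fin using (Fin)
open import Data.Fin.Properties using (_≟_)
open import Data.Product using (_,_; proj₁; proj₂)
open import Data.Sum using (_⊎_; inj₁; inj₂)
open import Relation.Nullary using (yes; no)
open import Relation.Binary.Definitions using (Decidable)
open import Relation.Binary.PropositionalEquality using (_≡_; refl)

module _ {c ℓ} (R : CommutativeRing c ℓ) where
  open CommutativeRing R
  open import Relation.Binary.Reasoning.Setoid setoid

  inverse-unique : ∀ {x y z} → x * z ≈ 1# → y * z ≈ 1# → x ≈ y
  inverse-unique {x} {y} {z} xz≈1 yz≈1 = begin
    x              ≈⟨ *-identityʳ x ⟨
    x * 1#         ≈⟨ *-congˡ yz≈1 ⟨
    x * (y * z)    ≈⟨ *-congˡ (*-comm y z) ⟩
    x * (z * y)    ≈⟨ *-assoc x z y ⟨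
    (x * z) * y    ≈⟨ *-congʳ xz≈1 ⟩
    1# * y         ≈⟨ *-identityˡ y ⟩
    y              ∎

  finite⇒≈-decidable : ∀ {q} → HasCardinality R q → Decidable _≈_
  finite⇒≈-decidable card x y with enum-sur x | enum-sur y
    where open HasCardinality card
  ... | i , eᵢ≈x | j , eⱼ≈y with i ≟ j
  ... | yes refl = yes (trans (sym eᵢ≈x) eⱼ≈y)
  ... | no i≢j   = no (λ x≈y → i≢j (HasCardinality.enum-inj card i j (trans eᵢ≈x (trans x≈y (sym eⱼ≈y)))))

module _ {c ℓ} (F : CommutativeRing c ℓ) (isField : IsField F) (_≈?_ : Decidable (CommutativeRing._≈_ F)) where
  open CommutativeRing F
  open IsField isField
  open import Algebra.Properties.Ring ring using (x[y-z]≈xy-xz; x∙y⁻¹≈ε⇒x≈y; +-inverseˡ-unique)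
  open import Relation.Binary.Reasoning.Setoid setoid

  x*y≈0⇒x≈0⊎y≈0 : ∀ {a b} → a * b ≈ 0# → a ≈ 0# ⊎ b ≈ 0#
  x*y≈0⇒x≈0⊎y≈0 {a} {b} ab≈0 with a ≈? 0#
  ... | yes a≈0 = inj₁ a≈0
  ... | no a≉0 with inverse a a≉0
  ... | a⁻¹ , aa⁻¹≈1 = inj₂ (begin
    b                 ≈⟨ *-identityˡ b ⟨
    1# * b            ≈⟨ *-congʳ aa⁻¹≈1 ⟨
    (a * a⁻¹) * b     ≈⟨ *-congʳ (*-comm a a⁻¹) ⟩
    (a⁻¹ * a) * b     ≈⟨ *-assoc a⁻¹ a b ⟩
    a⁻¹ * (a * b)     ≈⟨ *-congˡ ab≈0 ⟩
    a⁻¹ * 0#          ≈⟨ zeroʳ a⁻¹ ⟩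
    0#                ∎)

  x*x≈1⇒x≈1⊎x≈-1 : ∀ {x} → x * x ≈ 1# → x ≈ 1# ⊎ x ≈ - 1#
  x*x≈1⇒x≈1⊎x≈-1 {x} x²≈1 with x*y≈0⇒x≈0⊎y≈0 factored
    where
    factored : (x + 1#) * (x - 1#) ≈ 0#
    factored = begin
      (x + 1#) * (x - 1#)              ≈⟨ x[y-z]≈xy-xz (x + 1#) x 1# ⟩
      (x + 1#) * x - (x + 1#) * 1#     ≈⟨ +-cong (distribʳ x x 1#) (-‿cong (*-identityʳ (x + 1#))) ⟩
      (x * x + 1# * x) - (x + 1#)      ≈⟨ +-congʳ (+-cong x²≈1 (*-identityˡ x)) ⟩
      (1# + x) - (x + 1#)              ≈⟨ +-congʳ (+-comm 1# x) ⟩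
      (x + 1#) - (x + 1#)              ≈⟨ -‿inverseʳ (x + 1#) ⟩
      0#                               ∎
  ... | inj₁ x+1≈0 = inj₂ (+-inverseˡ-unique x 1# x+1≈0)
  ... | inj₂ x-1≈0 = inj₁ (x∙y⁻¹≈ε⇒x≈y x 1# x-1≈0)

open import Data.Nat using (ℕ; zero; suc; NonZero; _+_; _*_; _∸_; _%_; _/_; _≤_; z≤n; s≤s)
open import Data.Nat.Properties
  using (*-comm; +-identityʳ; *-identityˡ; *-distribʳ-+; ≤-reflexive; ≤-trans; m≤m+n; m≤n+m; +-mono-≤;
         +-0-commutativeMonoid; module ≤-Reasoning)
open import Data.Nat.DivMod using (_divMod_; result; m≡m%n+[m/n]*n; m%n<n; [m+kn]%n≡m%n; m∣n⇒o%n%m≡o%m; m*n/n≡m)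
open import Data.Nat.Divisibility using (_∣_; divides)
open import Data.Nat.Tactic.RingSolver using (solve-∀)
open import Data.Integer using (ℤ; 1ℤ; -1ℤ; _^_)
import Data.Integer as ℤ using (_*_)
open import Data.Integer.Properties using (^-distribˡ-+-*) renaming (*-identityʳ to ℤ-*-identityʳ)
open import Data.Fin using (zero; suc; _<_; punchIn)
open import Data.Fin.Properties using (_<?_; <-cmp; suc-injective; punchInᵢ≢i; 0≢1+n)
open import Data.Fin.Permutation using (permutation)
open import Data.List using (List; _++_; length; filter; concatMap; allFin; tabulate; map)
open import Data.List.Properties using (length-++; filter-++; map-tabulate)
open import Data.Product using (_×_; ∃)
open import Function using (_∘_; id; _⇔_; mk⇔; Equivalence)
open import Relation.Nullary using (¬_; Dec; contradiction)
open import Relation.Nullary.Decidable using (_×-dec_)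
open import Relation.Binary.Definitions using (tri<; tri≈; tri>)
open import Relation.Binary.PropositionalEquality using (_≢_; sym; trans; cong; cong₂; subst; module ≡-Reasoning)
open import Algebra.Properties.CommutativeMonoid.Sum +-0-commutativeMonoid
  using (sum; sum-cong-≗; sum-remove; sum-replicate-zero; sum-permute; ∑-distrib-+; ∑-comm)

𝟙[_] : ∀ {a} {A : Set a} → Dec A → ℕ
𝟙[ yes _ ] = 1
𝟙[ no _ ] = 0

𝟙-yes : ∀ {a} {A : Set a} → A → (a? : Dec A) → 𝟙[ a? ] ≡ 1
𝟙-yes a (yes _) = refl
𝟙-yes a (no ¬a) = contradiction a ¬a

𝟙-no : ∀ {a} {A : Set a} → ¬ A → (a? : Dec A) → 𝟙[ a? ] ≡ 0
𝟙-no ¬a (yes a) = contradiction a ¬a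
𝟙-no ¬a (no _) = refl

𝟙-cong : ∀ {a b} {A : Set a} {B : Set b} → A ⇔ B → (a? : Dec A) (b? : Dec B) → 𝟙[ a? ] ≡ 𝟙[ b? ]
𝟙-cong A⇔B (yes a) b? = sym (𝟙-yes (Equivalence.to A⇔B a) b?)
𝟙-cong A⇔B (no ¬a) b? = sym (𝟙-no (¬a ∘ Equivalence.from A⇔B) b?)

𝟙-×-dec : ∀ {a b} {A : Set a} {B : Set b} (a? : Dec A) (b? : Dec B) → 𝟙[ a? ×-dec b? ] ≡ 𝟙[ a? ] * 𝟙[ b? ]
𝟙-×-dec (yes _) (yes _) = refl
𝟙-×-dec (yes _) (no _) = refl
𝟙-×-dec (no _) _ = refl

𝟙-trichotomy : ∀ {n} (i j : Fin n) → 𝟙[ i <? j ] + 𝟙[ i ≟ j ] + 𝟙[ j <? i ] ≡ 1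
𝟙-trichotomy i j with <-cmp i j
... | tri< i<j i≢j j≮i rewrite 𝟙-yes i<j (i <? j) | 𝟙-no i≢j (i ≟ j) | 𝟙-no j≮i (j <? i) = refl
... | tri≈ i≮j i≡j j≮i rewrite 𝟙-no i≮j (i <? j) | 𝟙-yes i≡j (i ≟ j) | 𝟙-no j≮i (j <? i) = refl
... | tri> i≮j i≢j j<i rewrite 𝟙-no i≮j (i <? j) | 𝟙-no i≢j (i ≟ j) | 𝟙-yes j<i (j <? i) = refl

split-by-trichotomy : ∀ {n} (i j : Fin n) x → x ≡ 𝟙[ i <? j ] * x + 𝟙[ i ≟ j ] * x + 𝟙[ j <? i ] * x
split-by-trichotomy i j x = begin
  x                                                    ≡⟨ *-identityˡ x ⟨
  1 * x                                                ≡⟨ cong (_* x) (𝟙-trichotomy i j) ⟨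
  (𝟙[ i <? j ] + 𝟙[ i ≟ j ] + 𝟙[ j <? i ]) * x         ≡⟨ *-distribʳ-+ x (𝟙[ i <? j ] + 𝟙[ i ≟ j ]) _ ⟩
  (𝟙[ i <? j ] + 𝟙[ i ≟ j ]) * x + 𝟙[ j <? i ] * x     ≡⟨ cong (_+ 𝟙[ j <? i ] * x) (*-distribʳ-+ x 𝟙[ i <? j ] _) ⟩
  𝟙[ i <? j ] * x + 𝟙[ i ≟ j ] * x + 𝟙[ j <? i ] * x   ∎
  where open ≡-Reasoning

sum-≗0 : ∀ {n} {f : Fin n → ℕ} → (∀ i → f i ≡ 0) → sum f ≡ 0
sum-≗0 {n} f≗0 = trans (sum-cong-≗ f≗0) (sum-replicate-zero n)

sum≡single-term : ∀ {n} (i : Fin n) (f : Fin n → ℕ) → (∀ j → j ≢ i → f j ≡ 0) → sum f ≡ f i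
sum≡single-term {suc n} i f f≡0 = begin
  sum f                                ≡⟨ sum-remove {i = i} f ⟩
  f i + sum (λ j → f (punchIn i j))    ≡⟨ cong (f i +_) (sum-≗0 (λ j → f≡0 (punchIn i j) (punchInᵢ≢i i j))) ⟩
  f i + 0                              ≡⟨ +-identityʳ (f i) ⟩
  f i                                  ∎
  where open ≡-Reasoning

sum-delta : ∀ {n} (i : Fin n) (g : Fin n → ℕ) → sum (λ j → 𝟙[ i ≟ j ] * g j) ≡ g i
sum-delta i g = begin
  sum (λ j → 𝟙[ i ≟ j ] * g j)   ≡⟨ sum≡single-term i _ (λ j j≢i → cong (_* g j) (𝟙-no (j≢i ∘ sym) (i ≟ j))) ⟩
  𝟙[ i ≟ i ] * g i                ≡⟨ cong (_* g i) (𝟙-yes refl (i ≟ i)) ⟩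
  1 * g i                         ≡⟨ *-identityˡ (g i) ⟩
  g i                             ∎
  where open ≡-Reasoning

term≤sum : ∀ {n} (f : Fin n → ℕ) i → f i ≤ sum f
term≤sum {suc n} f i = subst (f i ≤_) (sym (sum-remove {i = i} f)) (m≤m+n (f i) _)

sum-mono-≤ : ∀ {n} {f g : Fin n → ℕ} → (∀ i → f i ≤ g i) → sum f ≤ sum g
sum-mono-≤ {zero} f≤g = z≤n
sum-mono-≤ {suc n} f≤g = +-mono-≤ (f≤g zero) (sum-mono-≤ (f≤g ∘ suc))

sum-𝟙-unique≤1 : ∀ {n p} {P : Fin n → Set p} (P? : ∀ i → Dec (P i)) →
                 (∀ i j → P i → P j → i ≡ j) → sum (λ i → 𝟙[ P? i ]) ≤ 1
sum-𝟙-unique≤1 {zero} P? unique = z≤n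
sum-𝟙-unique≤1 {suc n} P? unique with P? zero
... | yes p₀ = ≤-reflexive (cong suc (sum-≗0 (λ i → 𝟙-no (λ pᵢ → 0≢1+n (unique zero (suc i) p₀ pᵢ)) (P? (suc i)))))
... | no _   = sum-𝟙-unique≤1 (P? ∘ suc) (λ i j pᵢ pⱼ → suc-injective (unique (suc i) (suc j) pᵢ pⱼ))

sum-distrib-+₃ : ∀ {n} (f g h : Fin n → ℕ) → sum (λ i → f i + g i + h i) ≡ sum f + sum g + sum h
sum-distrib-+₃ f g h = trans (∑-distrib-+ (λ i → f i + g i) h) (cong (_+ sum h) (∑-distrib-+ f g))

sum-ones : ∀ n → sum {n} (λ _ → 1) ≡ n
sum-ones zero = refl
sum-ones (suc n) = cong suc (sum-ones n)

length-filter-tabulate : ∀ {b p} {B : Set b} {P : B → Set p} (P? : ∀ x → Dec (P x)) {m} (f : Fin m → B) →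
                         length (filter P? (tabulate f)) ≡ sum (λ i → 𝟙[ P? (f i) ])
length-filter-tabulate P? {zero} f = refl
length-filter-tabulate P? {suc m} f with P? (f zero)
... | yes _ = cong suc (length-filter-tabulate P? (f ∘ suc))
... | no _  = length-filter-tabulate P? (f ∘ suc)

length-filter-concatMap-tabulate : ∀ {b c p} {B : Set b} {C : Set c} {P : C → Set p} (P? : ∀ x → Dec (P x))
                                   (g : B → List C) {m} (f : Fin m → B) →
                                   length (filter P? (concatMap g (tabulate f))) ≡ sum (λ i → length (filter P? (g (f i))))
length-filter-concatMap-tabulate P? g {zero} f = refl
length-filter-concatMap-tabulate P? g {suc m} f = begin
  length (filter P? (g (f zero) ++ rest))                ≡⟨ cong length (filter-++ P? (g (f zero)) rest) ⟩
  length (filter P? (g (f zero)) ++ filter P? rest)      ≡⟨ length-++ (filter P? (g (f zero))) ⟩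
  length (filter P? (g (f zero))) + length (filter P? rest)
    ≡⟨ cong (length (filter P? (g (f zero))) +_) (length-filter-concatMap-tabulate P? g (f ∘ suc)) ⟩
  sum (λ i → length (filter P? (g (f i))))               ∎
  where
  open ≡-Reasoning
  rest = concatMap g (tabulate (f ∘ suc))

inversions-as-sum : ∀ {n} (σ : Fin n → Fin n) →
                    inversions σ ≡ sum (λ i → sum (λ j → 𝟙[ (i <? j) ×-dec (σ j <? σ i) ]))
inversions-as-sum {n} σ = begin
  inversions σ                                                   ≡⟨ length-filter-concatMap-tabulate P? row id ⟩
  sum (λ i → length (filter P? (map (i ,_) (allFin n))))         ≡⟨ sum-cong-≗ (λ i → cong (length ∘ filter P?) (map-tabulate id (i ,_))) ⟩
  sum (λ i → length (filter P? (tabulate (i ,_))))               ≡⟨ sum-cong-≗ (λ i → length-filter-tabulate P? (i ,_)) ⟩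
  sum (λ i → sum (λ j → 𝟙[ (i <? j) ×-dec (σ j <? σ i) ]))        ∎
  where
  open ≡-Reasoning
  P? : ∀ (p : Fin n × Fin n) → Dec (proj₁ p < proj₂ p × σ (proj₂ p) < σ (proj₁ p))
  P? (i , j) = (i <? j) ×-dec (σ j <? σ i)
  row : Fin n → List (Fin n × Fin n)
  row i = map (i ,_) (allFin n)

-1^[k*2]≡1 : ∀ k → -1ℤ ^ (k * 2) ≡ 1ℤ
-1^[k*2]≡1 zero = refl
-1^[k*2]≡1 (suc k) = cong (λ z → -1ℤ ℤ.* (-1ℤ ℤ.* z)) (-1^[k*2]≡1 k)

-1^[k+a*2]≡-1^k : ∀ k a → -1ℤ ^ (k + a * 2) ≡ -1ℤ ^ k
-1^[k+a*2]≡-1^k k a = begin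
  -1ℤ ^ (k + a * 2)              ≡⟨ ^-distribˡ-+-* -1ℤ k (a * 2) ⟩
  -1ℤ ^ k ℤ.* -1ℤ ^ (a * 2)      ≡⟨ cong (-1ℤ ^ k ℤ.*_) (-1^[k*2]≡1 a) ⟩
  -1ℤ ^ k ℤ.* 1ℤ                 ≡⟨ ℤ-*-identityʳ (-1ℤ ^ k) ⟩
  -1ℤ ^ k                        ∎
  where open ≡-Reasoning

-1^[a+k+a]≡-1^k : ∀ a k → -1ℤ ^ (a + k + a) ≡ -1ℤ ^ k
-1^[a+k+a]≡-1^k a k = trans (cong (-1ℤ ^_) (a+k+a≡k+a*2 a k)) (-1^[k+a*2]≡-1^k k a)
  where
  a+k+a≡k+a*2 : ∀ a k → a + k + a ≡ k + a * 2
  a+k+a≡k+a*2 = solve-∀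

-1^m≡-1^[m%2] : ∀ m → -1ℤ ^ m ≡ -1ℤ ^ (m % 2)
-1^m≡-1^[m%2] m = trans (cong (-1ℤ ^_) (m≡m%n+[m/n]*n m 2)) (-1^[k+a*2]≡-1^k (m % 2) (m / 2))

sgn≡-1^inversions : ∀ {n} (σ : Fin n → Fin n) → sgn σ ≡ -1ℤ ^ inversions σ
sgn≡-1^inversions σ rewrite -1^m≡-1^[m%2] (inversions σ) with inversions σ % 2 | m%n<n (inversions σ) 2
... | 0 | _ = refl
... | 1 | _ = refl
... | suc (suc _) | s≤s (s≤s ())

excedances : ∀ {n} → (Fin n → Fin n) → ℕ
excedances σ = sum (λ i → 𝟙[ i <? σ i ])

fixedPoints : ∀ {n} → (Fin n → Fin n) → ℕ
fixedPoints σ = sum (λ i → 𝟙[ i ≟ σ i ])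

module Involution {n} (σ : Fin n → Fin n) (σ-involutive : ∀ i → σ (σ i) ≡ i) where

  sum-∘σ : (f : Fin n → ℕ) → sum f ≡ sum (f ∘ σ)
  sum-∘σ f = sum-permute f (permutation σ σ σ-involutive σ-involutive)

  excedances-∘σ : sum (λ i → 𝟙[ σ i <? i ]) ≡ excedances σ
  excedances-∘σ = begin
    sum (λ i → 𝟙[ σ i <? i ])              ≡⟨ sum-∘σ _ ⟩
    sum (λ i → 𝟙[ σ (σ i) <? σ i ])        ≡⟨ sum-cong-≗ (λ i → cong (λ k → 𝟙[ k <? σ i ]) (σ-involutive i)) ⟩
    excedances σ                           ∎
    where open ≡-Reasoning

  size≡excedances+fixedPoints+excedances : n ≡ excedances σ + fixedPoints σ + excedances σ
  size≡excedances+fixedPoints+excedances = begin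
    n                                                                 ≡⟨ sum-ones n ⟨
    sum {n} (λ _ → 1)                                                 ≡⟨ sum-cong-≗ (λ i → sym (𝟙-trichotomy i (σ i))) ⟩
    sum (λ i → 𝟙[ i <? σ i ] + 𝟙[ i ≟ σ i ] + 𝟙[ σ i <? i ])          ≡⟨ sum-distrib-+₃ {n} _ _ _ ⟩
    excedances σ + fixedPoints σ + sum (λ i → 𝟙[ σ i <? i ])          ≡⟨ cong (excedances σ + fixedPoints σ +_) excedances-∘σ ⟩
    excedances σ + fixedPoints σ + excedances σ                       ∎
    where open ≡-Reasoning

  inversion below onto above : Fin n → Fin n → ℕ
  inversion i j = 𝟙[ (i <? j) ×-dec (σ j <? σ i) ]
  below i j = 𝟙[ i <? σ j ] * inversion i j
  onto i j = 𝟙[ i ≟ σ j ] * inversion i j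
  above i j = 𝟙[ σ j <? i ] * inversion i j

  onto≡excedance : ∀ i → sum (onto i) ≡ 𝟙[ i <? σ i ]
  onto≡excedance i = begin
    sum (onto i)                                          ≡⟨ sum-∘σ (onto i) ⟩
    sum (λ j → 𝟙[ i ≟ σ (σ j) ] * inversion i (σ j))      ≡⟨ sum-cong-≗ (λ j → cong (λ k → 𝟙[ i ≟ k ] * inversion i (σ j)) (σ-involutive j)) ⟩
    sum (λ j → 𝟙[ i ≟ j ] * inversion i (σ j))            ≡⟨ sum-delta i (inversion i ∘ σ) ⟩
    inversion i (σ i)                                     ≡⟨ 𝟙-cong (mk⇔ proj₁ (λ i<σi → i<σi , subst (_< σ i) (sym (σ-involutive i)) i<σi)) _ (i <? σ i) ⟩
    𝟙[ i <? σ i ]                                         ∎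
    where open ≡-Reasoning

  above-σ≡below : ∀ i j → above (σ i) (σ j) ≡ below j i
  above-σ≡below i j rewrite σ-involutive i | σ-involutive j = cong (𝟙[ j <? σ i ] *_) (begin
    𝟙[ (σ i <? σ j) ×-dec (j <? i) ]      ≡⟨ 𝟙-×-dec (σ i <? σ j) (j <? i) ⟩
    𝟙[ σ i <? σ j ] * 𝟙[ j <? i ]         ≡⟨ *-comm 𝟙[ σ i <? σ j ] _ ⟩
    𝟙[ j <? i ] * 𝟙[ σ i <? σ j ]         ≡⟨ 𝟙-×-dec (j <? i) (σ i <? σ j) ⟨
    𝟙[ (j <? i) ×-dec (σ i <? σ j) ]      ∎)
    where open ≡-Reasoning

  sum-above≡sum-below : sum (λ i → sum (above i)) ≡ sum (λ i → sum (below i))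
  sum-above≡sum-below = begin
    sum (λ i → sum (above i))                     ≡⟨ sum-∘σ _ ⟩
    sum (λ i → sum (above (σ i)))                 ≡⟨ sum-cong-≗ (λ i → sum-∘σ (above (σ i))) ⟩
    sum (λ i → sum (λ j → above (σ i) (σ j)))     ≡⟨ ∑-comm (λ i j → above (σ i) (σ j)) ⟩
    sum (λ j → sum (λ i → above (σ i) (σ j)))     ≡⟨ sum-cong-≗ (λ j → sum-cong-≗ (λ i → above-σ≡below i j)) ⟩
    sum (λ j → sum (below j))                     ∎
    where open ≡-Reasoning

  inversions≡a+excedances+a : ∃ λ a → inversions σ ≡ a + excedances σ + a
  inversions≡a+excedances+a = sum (λ i → sum (below i)) , (begin
    inversions σ                                                    ≡⟨ inversions-as-sum σ ⟩
    sum (λ i → sum (inversion i))                                   ≡⟨ sum-cong-≗ (λ i → sum-cong-≗ (λ j → split-by-trichotomy i (σ j) (inversion i j))) ⟩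
    sum (λ i → sum (λ j → below i j + onto i j + above i j))        ≡⟨ sum-cong-≗ (λ i → sum-distrib-+₃ (below i) (onto i) (above i)) ⟩
    sum (λ i → sum (below i) + sum (onto i) + sum (above i))        ≡⟨ sum-distrib-+₃ (sum ∘ below) (sum ∘ onto) (sum ∘ above) ⟩
    sum (λ i → sum (below i)) + sum (λ i → sum (onto i)) + sum (λ i → sum (above i))
      ≡⟨ cong₂ (λ x y → sum (λ i → sum (below i)) + x + y) (sum-cong-≗ onto≡excedance) sum-above≡sum-below ⟩
    sum (λ i → sum (below i)) + excedances σ + sum (λ i → sum (below i)) ∎)
    where open ≡-Reasoning

  sgn≡-1^excedances : sgn σ ≡ -1ℤ ^ excedances σ
  sgn≡-1^excedances with inversions≡a+excedances+a
  ... | a , inversions≡ = begin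
    sgn σ                              ≡⟨ sgn≡-1^inversions σ ⟩
    -1ℤ ^ inversions σ                 ≡⟨ cong (-1ℤ ^_) inversions≡ ⟩
    -1ℤ ^ (a + excedances σ + a)       ≡⟨ -1^[a+k+a]≡-1^k a (excedances σ) ⟩
    -1ℤ ^ excedances σ                 ∎
    where open ≡-Reasoning

SignLaw : ℕ → ℤ → Set
SignLaw n s = ((2 * n + 1) % 4 ≡ 3 → s ≡ -1ℤ ^ ((n ∸ 1) / 2)) ×
              ((2 * n + 1) % 8 ≡ 5 → s ≡ 1ℤ) ×
              ((2 * n + 1) % 8 ≡ 1 → s ≡ -1ℤ)

≡[m+kn]⇒%n≡m%n : ∀ {x} r k d .{{_ : NonZero d}} → x ≡ r + k * d → x % d ≡ r % d
≡[m+kn]⇒%n≡m%n r k d refl = [m+kn]%n≡m%n r k d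

m%8≡r⇒m%4≡r%4 : ∀ x {r} → x % 8 ≡ r → x % 4 ≡ r % 4
m%8≡r⇒m%4≡r%4 x x%8≡r = trans (sym (m∣n⇒o%n%m≡o%m 4 8 x (divides 2 refl))) (cong (_% 4) x%8≡r)

signLaw-odd : ∀ t → SignLaw (t + 1 + t) (-1ℤ ^ t)
signLaw-odd t = (λ _ → cong (-1ℤ ^_) (sym half))
              , (λ q%8≡5 → contradiction (trans (sym q%4≡3) (m%8≡r⇒m%4≡r%4 q q%8≡5)) λ ())
              , (λ q%8≡1 → contradiction (trans (sym q%4≡3) (m%8≡r⇒m%4≡r%4 q q%8≡1)) λ ())
  where
  q = 2 * (t + 1 + t) + 1
  q≡ : ∀ t → 2 * (t + 1 + t) + 1 ≡ 3 + t * 4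
  q≡ = solve-∀
  n≡ : ∀ t → t + 1 + t ≡ 1 + t * 2
  n≡ = solve-∀
  q%4≡3 : q % 4 ≡ 3
  q%4≡3 = ≡[m+kn]⇒%n≡m%n 3 t 4 (q≡ t)
  half : (t + 1 + t ∸ 1) / 2 ≡ t
  half = trans (cong (λ m → (m ∸ 1) / 2) (n≡ t)) (m*n/n≡m t 2)

signLaw-even-mod8 : ∀ t → ((2 * (t + 2 + t) + 1) % 8 ≡ 5 → -1ℤ ^ t ≡ 1ℤ) ×
                           ((2 * (t + 2 + t) + 1) % 8 ≡ 1 → -1ℤ ^ t ≡ -1ℤ)
signLaw-even-mod8 t with t divMod 2
... | result k zero refl =
  (λ _ → -1^[k*2]≡1 k) , (λ q%8≡1 → contradiction (trans (sym q%8≡5) q%8≡1) λ ())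
  where
  q≡ : ∀ k → 2 * (k * 2 + 2 + k * 2) + 1 ≡ 5 + k * 8
  q≡ = solve-∀
  q%8≡5 : (2 * (k * 2 + 2 + k * 2) + 1) % 8 ≡ 5
  q%8≡5 = ≡[m+kn]⇒%n≡m%n 5 k 8 (q≡ k)
... | result k (suc zero) refl =
  (λ q%8≡5 → contradiction (trans (sym q%8≡1) q%8≡5) λ ()) , (λ _ → cong (-1ℤ ℤ.*_) (-1^[k*2]≡1 k))
  where
  q≡ : ∀ k → 2 * (1 + k * 2 + 2 + (1 + k * 2)) + 1 ≡ 1 + (1 + k) * 8
  q≡ = solve-∀
  q%8≡1 : (2 * (1 + k * 2 + 2 + (1 + k * 2)) + 1) % 8 ≡ 1
  q%8≡1 = ≡[m+kn]⇒%n≡m%n 1 (1 + k) 8 (q≡ k)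

signLaw-even : ∀ t → SignLaw (t + 2 + t) (-1ℤ ^ t)
signLaw-even t = (λ q%4≡3 → contradiction (trans (sym q%4≡1) q%4≡3) λ ()) , signLaw-even-mod8 t
  where
  q≡ : ∀ t → 2 * (t + 2 + t) + 1 ≡ 1 + (1 + t) * 4
  q≡ = solve-∀
  q%4≡1 : (2 * (t + 2 + t) + 1) % 4 ≡ 1
  q%4≡1 = ≡[m+kn]⇒%n≡m%n 1 (1 + t) 4 (q≡ t)

signLaw : ∀ {n} t f → n ≡ t + f + t → 1 ≤ f → f ≤ 2 → SignLaw n (-1ℤ ^ t)
signLaw t 1 refl _ _ = signLaw-odd t
signLaw t 2 refl _ _ = signLaw-even t
signLaw t (suc (suc (suc _))) _ _ (s≤s (s≤s ()))

module _ {c ℓ} (F : CommutativeRing c ℓ) where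
  private module F = CommutativeRing F

  module SquareInversion (isField : IsField F) {q} (card : HasCardinality F q)
                         {n} (α : Fin n → F.Carrier) (squares : EnumeratesNonzeroSquares F n α)
                         (σ : Fin n → Fin n) (σ-inverts : ∀ i → α (σ i) F.* α i F.≈ F.1#) where
    open EnumeratesNonzeroSquares squares
    open IsField isField using (0≉1)

    _≈?_ : Decidable F._≈_
    _≈?_ = finite⇒≈-decidable F card

    σ-involutive : ∀ i → σ (σ i) ≡ i
    σ-involutive i = α-inj _ _ (inverse-unique F (σ-inverts (σ i)) (F.trans (F.*-comm (α i) (α (σ i))) (σ-inverts i)))

    square≈1⇒fixed : ∀ {i} → α i F.* α i F.≈ F.1# → σ i ≡ i
    square≈1⇒fixed {i} αᵢ²≈1 = α-inj _ _ (inverse-unique F (σ-inverts i) αᵢ²≈1)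

    fixed⇒square≈1 : ∀ {i} → σ i ≡ i → α i F.* α i F.≈ F.1#
    fixed⇒square≈1 {i} σi≡i = subst (λ k → α k F.* α i F.≈ F.1#) σi≡i (σ-inverts i)

    1≤fixedPoints : 1 ≤ fixedPoints σ
    1≤fixedPoints = subst (_≤ fixedPoints σ) (𝟙-yes (sym (square≈1⇒fixed α₁²≈1)) (i₁ ≟ σ i₁)) (term≤sum _ i₁)
      where
      one-is-square = α-sur F.1# (λ 1≈0 → 0≉1 (F.sym 1≈0))
      i₁ = proj₁ one-is-square
      α₁≈1 : α i₁ F.≈ F.1#
      α₁≈1 = F.trans (proj₂ one-is-square) (F.*-identityˡ F.1#)
      α₁²≈1 : α i₁ F.* α i₁ F.≈ F.1#
      α₁²≈1 = F.trans (F.*-cong α₁≈1 α₁≈1) (F.*-identityˡ F.1#)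

    fixedPoints≤2 : fixedPoints σ ≤ 2
    fixedPoints≤2 = begin
      fixedPoints σ                                            ≤⟨ sum-mono-≤ fixed≤ ⟩
      sum (λ i → 𝟙[ α i ≈? F.1# ] + 𝟙[ α i ≈? (F.- F.1#) ])     ≡⟨ ∑-distrib-+ {n} _ _ ⟩
      sum (λ i → 𝟙[ α i ≈? F.1# ]) + sum (λ i → 𝟙[ α i ≈? (F.- F.1#) ])
        ≤⟨ +-mono-≤ (at-most-one F.1#) (at-most-one (F.- F.1#)) ⟩
      2                                                        ∎
      where
      open ≤-Reasoning
      at-most-one : ∀ x → sum (λ i → 𝟙[ α i ≈? x ]) ≤ 1
      at-most-one x = sum-𝟙-unique≤1 (λ i → α i ≈? x) (λ i j αᵢ≈x αⱼ≈x → α-inj i j (F.trans αᵢ≈x (F.sym αⱼ≈x)))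
      fixed≤ : ∀ i → 𝟙[ i ≟ σ i ] ≤ 𝟙[ α i ≈? F.1# ] + 𝟙[ α i ≈? (F.- F.1#) ]
      fixed≤ i with i ≟ σ i
      ... | no _ = z≤n
      ... | yes i≡σi with x*x≈1⇒x≈1⊎x≈-1 F isField _≈?_ (fixed⇒square≈1 (sym i≡σi))
      ... | inj₁ αᵢ≈1  = ≤-trans (≤-reflexive (sym (𝟙-yes αᵢ≈1 (α i ≈? F.1#)))) (m≤m+n _ _)
      ... | inj₂ αᵢ≈-1 = ≤-trans (≤-reflexive (sym (𝟙-yes αᵢ≈-1 (α i ≈? (F.- F.1#))))) (m≤n+m _ _)

lemma3p2 : ∀ {c ℓ : Level} (n : ℕ) → IsPrimePower (2 * n + 1) → ¬ (3 ∣ (2 * n + 1)) →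
    (F : CommutativeRing c ℓ) → IsField F → HasCardinality F (2 * n + 1) →
    (α : Fin n → CommutativeRing.Carrier F) → EnumeratesNonzeroSquares F n α →
    (inv : Fin n → Fin n) →
    (∀ i → CommutativeRing._≈_ F (CommutativeRing._*_ F (α (inv i)) (α i)) (CommutativeRing.1# F)) →
    ((2 * n + 1) % 4 ≡ 3 → sgn inv ≡ -1ℤ ^ ((n ∸ 1) / 2)) ×
    ((2 * n + 1) % 8 ≡ 5 → sgn inv ≡ 1ℤ) ×
    ((2 * n + 1) % 8 ≡ 1 → sgn inv ≡ -1ℤ)
lemma3p2 n _ _ F isField card α squares inv α-inv =
  subst (SignLaw n) (sym sgn≡-1^excedances)
    (signLaw (excedances inv) (fixedPoints inv) size≡excedances+fixedPoints+excedances 1≤fixedPoints fixedPoints≤2)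
  where
  open SquareInversion F isField card α squares inv α-inv
  open Involution inv σ-involutive
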